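{- Let $k\ge1$ and let $G_i=(V_i,E_i)$, $i=1,\dots,k$, be finite bipartite graphs such that there is a partition $(V_s,V_t)$ of $\bigcup_{i=1}^kV_i$ with every edge of every $E_i$ having one endpoint in $V_s$ and one in $V_t$. Let $\lambda^i_v\ge0$ for $v\in V_i\cap V_{i+1}$. Consider the linear program with variables $y^i\in\mathbb{R}^{V_i}$ ($i=1,\dots,k$) and $\delta^i,d^i\in\mathbb{R}^{V_i\cap V_{i+1}}$ ($i=1,\dots,k-1$): $$\min\sum_{i=1}^{k-1}\sum_{v\in V_i\cap V_{i+1}}\lambda^i_v(\delta^i_v+d^i_v)$$ subject to $y^i_u+y^i_v\ge1$ for all $uv\in E_i$; $\sum_{v\in V_i}y^i_v=\nu(G_i)$; $y^i\ge0$ ($i=1,\dots,k$); $y^i_v-y^{i+1}_v\le\delta^i_v$ and $y^{i+1}_v-y^i_v\le d^i_v$ for all $v\in V_i\cap V_{i+1}$; $\delta^i,d^i\ge0$ ($i=1,\dots,k-1$). Then the feasible region of this linear program is an integral polyhedron.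
   Context: For a graph $G$, $\nu(G)$ denotes the maximum cardinality of a matching. A polyhedron is integral if each of its nonempty faces contains an integer point (equivalently, for this pointed polyhedron, all vertices are integral).
   Formalization: The feasible region is taken over ℚ rather than ℝ: the variables $y^i$, $\delta^i$, $d^i$, the weights $\lambda^i_v$ and the inequalities cutting out its faces are rational. -}

module Defs where

open import Data.Nat using (ℕ; zero; suc)
open import Data.Integer using (ℤ; +_)
open import Data.Rational using (ℚ; _/_; _+_; _-_; _*_; _≤_; 0ℚ; 1ℚ)
open import Data.Fin using (Fin; zero; suc; inject₁)
open import Data.Bool using (Bool; true; false; _∧_)
open import Data.Product using (_×_; _,_; proj₁; proj₂; ∃)
open import Data.List using (List; []; _∷_; length; concatMap)
open import Data.List.Relation.Unary.All using (All)
open import Data.List.Relation.Unary.Unique.Propositional using (Unique)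
open import Relation.Binary.PropositionalEquality using (_≡_; _≢_)

sumFin : {n : ℕ} → (Fin n → ℚ) → ℚ
sumFin {zero}  f = 0ℚ
sumFin {suc n} f = f zero + sumFin (λ i → f (suc i))

ℕtoℚ : ℕ → ℚ
ℕtoℚ n = (+ n) / 1

IsInt : ℚ → Set
IsInt q = ∃ λ (z : ℤ) → q ≡ z / 1

-- Graphs on the common vertex universe Fin n.
-- A graph is given by a vertex subset V : Fin n → Bool and a (directed
-- listing of an undirected) edge relation E : Fin n → Fin n → Bool.

IsMatching : {n : ℕ} → (Fin n → Fin n → Bool) → List (Fin n × Fin n) → Set
IsMatching E M =
  All (λ e → E (proj₁ e) (proj₂ e) ≡ true) M ×
  Unique (concatMap (λ e → proj₁ e ∷ proj₂ e ∷ []) M)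

IsMatchingNumber : {n : ℕ} → (Fin n → Fin n → Bool) → ℕ → Set
IsMatchingNumber E m =
  (∃ λ M → IsMatching E M × length M ≡ m) ×
  (∀ M → IsMatching E M → Data.Nat._≤_ (length M) m)

-- Points of the LP.  k = suc m graphs, vertex universe Fin n.
-- y i v for i : Fin k; δ j v, d j v for j : Fin m, referring to the
-- pair (G_j, G_{j+1}) = (G (inject₁ j), G (suc j)).
-- Coordinates outside V_i (resp. V_j ∩ V_{j+1}) are forced to be 0,
-- which gives a polyhedron affinely-lattice-isomorphic to the original.

record Point (m n : ℕ) : Set where
  field
    y : Fin (suc m) → Fin n → ℚ
    δ : Fin m → Fin n → ℚ
    d : Fin m → Fin n → ℚ
open Point public

dot : {m n : ℕ} → Point m n → Point m n → ℚ
dot c x =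
  sumFin (λ i → sumFin (λ v → y c i v * y x i v)) +
  sumFin (λ j → sumFin (λ v → (δ c j v * δ x j v) + (d c j v * d x j v)))

IntPoint : {m n : ℕ} → Point m n → Set
IntPoint x =
  (∀ i v → IsInt (y x i v)) × (∀ j v → IsInt (δ x j v)) × (∀ j v → IsInt (d x j v))

Feasible : {m n : ℕ} →
  (V : Fin (suc m) → Fin n → Bool) →
  (E : Fin (suc m) → Fin n → Fin n → Bool) →
  (ν : Fin (suc m) → ℕ) → Point m n → Set
Feasible {m} {n} V E ν x =
  (∀ i u v → E i u v ≡ true → 1ℚ ≤ (y x i u + y x i v)) ×
  (∀ i → sumFin (λ v → y x i v) ≡ ℕtoℚ (ν i)) ×
  (∀ i v → 0ℚ ≤ y x i v) ×
  (∀ i v → V i v ≡ false → y x i v ≡ 0ℚ) ×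
  (∀ j v → (V (inject₁ j) v ∧ V (suc j) v) ≡ true →
       ((y x (inject₁ j) v - y x (suc j) v) ≤ δ x j v) ×
       ((y x (suc j) v - y x (inject₁ j) v) ≤ d x j v)) ×
  (∀ j v → (0ℚ ≤ δ x j v) × (0ℚ ≤ d x j v)) ×
  (∀ j v → (V (inject₁ j) v ∧ V (suc j) v) ≡ false →
       (δ x j v ≡ 0ℚ) × (d x j v ≡ 0ℚ))

IsIntegral : {m n : ℕ} → (Point m n → Set) → Set
IsIntegral {m} {n} P =
  ∀ (c : Point m n) (β : ℚ) →
  (∀ x → P x → dot c x ≤ β) →
  (∃ λ x → P x × dot c x ≡ β) →
  ∃ λ x → P x × IntPoint x × dot c x ≡ β

{-# OPTIONS --safe #-}
-- Fix a face {x ∈ P : c · x = β} and a point x on it. Replacing δ and d by the positive parts of the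
-- differences of consecutive y's keeps the point on the face, so only the y-part matters; each y^i is
-- then a fractional vertex cover of G_i of weight ν(G_i), hence bounded by 1. Read the vertices on one
-- side of the bipartition through p ↦ 1 - p. If some entry is fractional, with value t ∈ (0,1) in this
-- reading, split every entry as p = t · min(p,t)/t + (1 - t) · (p - t)⁺/(1 - t). Both parts are
-- monotone in p and fix 0 and 1, so they keep every edge covered, keep integral entries integral and
-- preserve the sign of each difference y^i_v - y^{i+1}_v, so that δ and d split along; by weak duality
-- both parts still weigh ν(G_i). A face containing a proper convex combination of two feasible points
-- contains both, and the second part has fewer fractional entries, the chosen one having become 0 or 1.
module Submission where

open import Defs
open import Algebra.Bundles using (CommutativeMonoid)
open import Data.Bool using (Bool; true; false; _∧_)
open import Data.Empty using (⊥-elim)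
open import Data.Fin using (Fin; zero; suc; inject₁)
open import Data.Fin.Properties using (any?) renaming (_≟_ to _≟ᶠ_)
open import Data.Integer as ℤ using ()
import Data.Integer.Properties as ℤₚ
open import Data.List using (List; []; _∷_; length; concatMap)
open import Data.List.Relation.Unary.All using (All; []; _∷_)
open import Data.List.Relation.Unary.AllPairs using ([]; _∷_)
open import Data.List.Relation.Unary.Unique.Propositional using (Unique)
open import Data.Nat as ℕ using (ℕ; zero; suc)
import Data.Nat.Coprimality as Coprimality
open import Data.Nat.Induction using (<-wellFounded)
import Data.Nat.Properties as ℕₚ
open import Data.Product using (_×_; _,_; proj₁; proj₂; ∃)
open import Data.Rational
  using (ℚ; _/_; 0ℚ; 1ℚ; ½; _+_; _*_; _-_; -_; _≤_; _<_; _⊓_; _⊔_; 1/_; *<*; NonZero;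
         positive; nonNegative; nonPositive; >-nonZero)
open import Data.Rational.Properties
open import Data.Rational.Solver using (module +-*-Solver)
open import Data.Sum using (_⊎_; inj₁; inj₂)
open import Data.Vec.Functional using (updateAt)
open import Data.Vec.Functional.Properties using (updateAt-updates; updateAt-minimal)
open import Function using (_∘_)
open import Induction.WellFounded using (Acc; acc)
open import Relation.Binary.Core using (_Preserves_⟶_)
open import Relation.Binary.PropositionalEquality
open import Relation.Nullary using (¬_; Dec; yes; no)
open import Relation.Nullary.Decidable using (_⊎-dec_; ¬?; decidable-stable)

open import Algebra.Properties.CommutativeSemigroup (CommutativeMonoid.commutativeSemigroup +-0-commutativeMonoid)
  using (x∙yz≈y∙xz)
open +-*-Solver using (solve; _:+_; _:*_; _:-_; :-_; _:=_; con)

0≤1 : 0ℚ ≤ 1ℚ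
0≤1 = nonNegative⁻¹ 1ℚ

0<½ : 0ℚ < ½
0<½ = positive⁻¹ ½

½<1 : ½ < 1ℚ
½<1 = *<* (ℤ.+<+ (ℕ.s≤s (ℕ.s≤s ℕ.z≤n)))

p≤q⇒p-q≤0 : ∀ {p q} → p ≤ q → p - q ≤ 0ℚ
p≤q⇒p-q≤0 {p} {q} p≤q = subst (p - q ≤_) (+-inverseʳ q) (+-monoˡ-≤ (- q) p≤q)

p≤q⇒0≤q-p : ∀ {p q} → p ≤ q → 0ℚ ≤ q - p
p≤q⇒0≤q-p {p} {q} p≤q = subst (_≤ q - p) (+-inverseʳ p) (+-monoˡ-≤ (- p) p≤q)

p<1⇒0<1-p : ∀ {p} → p < 1ℚ → 0ℚ < 1ℚ - p
p<1⇒0<1-p {p} p<1 = subst (_< 1ℚ - p) (+-inverseʳ p) (+-monoˡ-< (- p) p<1)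

p≤p+q : ∀ {p q} → 0ℚ ≤ q → p ≤ p + q
p≤p+q {p} {q} 0≤q = subst (_≤ p + q) (+-identityʳ p) (+-monoʳ-≤ p 0≤q)

p≤q+p : ∀ {p q} → 0ℚ ≤ q → p ≤ q + p
p≤q+p {p} {q} 0≤q = subst (_≤ q + p) (+-identityˡ p) (+-monoˡ-≤ p 0≤q)

+-cancelʳ-≤ : ∀ {p q r} → p + r ≤ q + r → p ≤ q
+-cancelʳ-≤ {p} {q} {r} p+r≤q+r = subst₂ _≤_ (cancel p) (cancel q) (+-monoˡ-≤ (- r) p+r≤q+r)
  where
  cancel : ∀ x → x + r - r ≡ x
  cancel x = solve 2 (λ x r → x :+ r :- r := x) refl x r

0≤p*q : ∀ {p q} → 0ℚ ≤ p → 0ℚ ≤ q → 0ℚ ≤ p * q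
0≤p*q {p} {q} 0≤p 0≤q = nonNegative⁻¹ _ {{nonNeg*nonNeg⇒nonNeg p {{nonNegative 0≤p}} q {{nonNegative 0≤q}}}}

p*q≤0 : ∀ {p q} → 0ℚ ≤ p → q ≤ 0ℚ → p * q ≤ 0ℚ
p*q≤0 {p} {q} 0≤p q≤0 = nonPositive⁻¹ _ {{nonNeg*nonPos⇒nonPos p {{nonNegative 0≤p}} q {{nonPositive q≤0}}}}

module _ {t : ℚ} (0<t : 0ℚ < t) (t<1 : t < 1ℚ) where

  private
    ≥-by-cancel : ∀ {s A N p q} → 0ℚ < s → p ≤ q → s * N ≡ N - q → s * A ≡ N - p → N ≤ A
    ≥-by-cancel {s} {A} {N} {p} {q} 0<s p≤q sN≡N-q sA≡N-p = *-cancelˡ-≤-pos s {{positive 0<s}} (begin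
      s * N  ≡⟨ sN≡N-q ⟩
      N - q  ≤⟨ +-monoʳ-≤ N (neg-antimono-≤ p≤q) ⟩
      N - p  ≡⟨ sym sA≡N-p ⟩
      s * A  ∎)
      where open ≤-Reasoning

  -- t N = N - (1 - t) N ≤ N - (1 - t) B = t A, then cancel t; symmetrically for B.
  convex-tight-≤ : ∀ {A B N} → A ≤ N → B ≤ N → t * A + (1ℚ - t) * B ≡ N → A ≡ N × B ≡ N
  convex-tight-≤ {A} {B} {N} A≤N B≤N eq =
    ≤-antisym A≤N (≥-by-cancel 0<t (*-monoˡ-≤-nonNeg (1ℚ - t) {{nonNegative (<⇒≤ (p<1⇒0<1-p t<1))}} B≤N)
                     (solve 2 (λ t N → t :* N := N :- (con 1ℚ :- t) :* N) refl t N)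
                     (trans (solve 3 (λ t A B → t :* A := (t :* A :+ (con 1ℚ :- t) :* B) :- (con 1ℚ :- t) :* B)
                                     refl t A B)
                            (cong (_- (1ℚ - t) * B) eq))) ,
    ≤-antisym B≤N (≥-by-cancel (p<1⇒0<1-p t<1) (*-monoˡ-≤-nonNeg t {{nonNegative (<⇒≤ 0<t)}} A≤N)
                     (solve 2 (λ t N → (con 1ℚ :- t) :* N := N :- t :* N) refl t N)
                     (trans (solve 3 (λ t A B → (con 1ℚ :- t) :* B := (t :* A :+ (con 1ℚ :- t) :* B) :- t :* A)
                                     refl t A B)
                            (cong (_- t * A) eq)))

  convex-tight-≥ : ∀ {A B N} → N ≤ A → N ≤ B → t * A + (1ℚ - t) * B ≡ N → A ≡ N × B ≡ N
  convex-tight-≥ {A} {B} {N} N≤A N≤B eq =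
    let -A≡-N , -B≡-N = convex-tight-≤ (neg-antimono-≤ N≤A) (neg-antimono-≤ N≤B) (trans negated (cong -_ eq))
    in neg-injective -A≡-N , neg-injective -B≡-N
    where
    negated : t * (- A) + (1ℚ - t) * (- B) ≡ - (t * A + (1ℚ - t) * B)
    negated = solve 3 (λ t A B → t :* (:- A) :+ (con 1ℚ :- t) :* (:- B) := :- (t :* A :+ (con 1ℚ :- t) :* B)) refl t A B

ℕtoℚ-suc : ∀ k → ℕtoℚ (suc k) ≡ 1ℚ + ℕtoℚ k
ℕtoℚ-suc k = sym (begin
  1ℚ + ℕtoℚ k
    ≡⟨ cong (1ℚ +_) (normalize-coprime (Coprimality.sym (Coprimality.1-coprimeTo k))) ⟩
  (ℤ.+ 1 ℤ.+ ℤ.+ k ℤ.* ℤ.+ 1) / 1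
    ≡⟨ cong (λ z → (ℤ.+ 1 ℤ.+ z) / 1) (ℤₚ.*-identityʳ (ℤ.+ k)) ⟩
  ℕtoℚ (suc k)
    ∎)
  where open ≡-Reasoning

infix 10 _⁺

_⁺ : ℚ → ℚ
p ⁺ = p ⊔ 0ℚ

0≤p⁺ : ∀ p → 0ℚ ≤ p ⁺
0≤p⁺ p = p≤q⊔p p 0ℚ

p≤p⁺ : ∀ p → p ≤ p ⁺
p≤p⁺ p = p≤p⊔q p 0ℚ

0≤p⇒p⁺≡p : ∀ {p} → 0ℚ ≤ p → p ⁺ ≡ p
0≤p⇒p⁺≡p = p≥q⇒p⊔q≡p

p≤0⇒p⁺≡0 : ∀ {p} → p ≤ 0ℚ → p ⁺ ≡ 0ℚ
p≤0⇒p⁺≡0 = p≤q⇒p⊔q≡q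

SameSign : ℚ → ℚ → Set
SameSign p q = (0ℚ ≤ p × 0ℚ ≤ q) ⊎ (p ≤ 0ℚ × q ≤ 0ℚ)

⁺-linear : ∀ {a b p q} → 0ℚ ≤ a → 0ℚ ≤ b → SameSign p q → (a * p + b * q) ⁺ ≡ a * p ⁺ + b * q ⁺
⁺-linear {a} {b} {p} {q} 0≤a 0≤b (inj₁ (0≤p , 0≤q)) = begin
  (a * p + b * q) ⁺  ≡⟨ 0≤p⇒p⁺≡p (+-mono-≤ (0≤p*q 0≤a 0≤p) (0≤p*q 0≤b 0≤q)) ⟩
  a * p + b * q      ≡⟨ sym (cong₂ (λ x y → a * x + b * y) (0≤p⇒p⁺≡p 0≤p) (0≤p⇒p⁺≡p 0≤q)) ⟩
  a * p ⁺ + b * q ⁺  ∎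
  where open ≡-Reasoning
⁺-linear {a} {b} {p} {q} 0≤a 0≤b (inj₂ (p≤0 , q≤0)) = begin
  (a * p + b * q) ⁺  ≡⟨ p≤0⇒p⁺≡0 (+-mono-≤ (p*q≤0 0≤a p≤0) (p*q≤0 0≤b q≤0)) ⟩
  0ℚ                 ≡⟨ solve 2 (λ a b → con 0ℚ := a :* con 0ℚ :+ b :* con 0ℚ) refl a b ⟩
  a * 0ℚ + b * 0ℚ    ≡⟨ sym (cong₂ (λ x y → a * x + b * y) (p≤0⇒p⁺≡0 p≤0) (p≤0⇒p⁺≡0 q≤0)) ⟩
  a * p ⁺ + b * q ⁺  ∎
  where open ≡-Reasoning

IsBinary : ℚ → Set
IsBinary p = p ≡ 0ℚ ⊎ p ≡ 1ℚ

binary? : ∀ p → Dec (IsBinary p)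
binary? p = p ≟ 0ℚ ⊎-dec p ≟ 1ℚ

binary⇒int : ∀ {p} → IsBinary p → IsInt p
binary⇒int (inj₁ refl) = ℤ.+ 0 , refl
binary⇒int (inj₂ refl) = ℤ.+ 1 , refl

unit-nonBinary⇒open : ∀ {p} → 0ℚ ≤ p → p ≤ 1ℚ → ¬ IsBinary p → 0ℚ < p × p < 1ℚ
unit-nonBinary⇒open {p} 0≤p p≤1 ¬binary = 0<p , p<1
  where
  0<p : 0ℚ < p
  0<p with 0ℚ <? p
  ... | yes 0<p = 0<p
  ... | no  0≮p = ⊥-elim (¬binary (inj₁ (≤-antisym (≮⇒≥ 0≮p) 0≤p)))
  p<1 : p < 1ℚ
  p<1 with p <? 1ℚ
  ... | yes p<1 = p<1
  ... | no  p≮1 = ⊥-elim (¬binary (inj₂ (≤-antisym p≤1 (≮⇒≥ p≮1))))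

difference⁺-binary : ∀ {p q} → IsBinary p → IsBinary q → IsBinary ((p - q) ⁺)
difference⁺-binary (inj₁ refl) (inj₁ refl) = inj₁ refl
difference⁺-binary (inj₁ refl) (inj₂ refl) = inj₁ refl
difference⁺-binary (inj₂ refl) (inj₁ refl) = inj₂ refl
difference⁺-binary (inj₂ refl) (inj₂ refl) = inj₁ refl

countNo : ∀ {A : Set} → Dec A → ℕ
countNo (yes _) = 0
countNo (no _)  = 1

countNo-≤ : ∀ {A B : Set} (a? : Dec A) (b? : Dec B) → (A → B) → countNo b? ℕ.≤ countNo a?
countNo-≤ _       (yes _) _   = ℕ.z≤n
countNo-≤ (no _)  (no _)  _   = ℕₚ.≤-refl
countNo-≤ (yes a) (no ¬b) a⇒b = ⊥-elim (¬b (a⇒b a))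

countNo-< : ∀ {A B : Set} (a? : Dec A) (b? : Dec B) → ¬ A → B → countNo b? ℕ.< countNo a?
countNo-< (no _)  (yes _) _  _ = ℕ.s≤s ℕ.z≤n
countNo-< (yes a) _       ¬a _ = ⊥-elim (¬a a)
countNo-< _       (no ¬b) _  b = ⊥-elim (¬b b)

sumℕ : ∀ {k} → (Fin k → ℕ) → ℕ
sumℕ {zero}  f = 0
sumℕ {suc k} f = f zero ℕ.+ sumℕ (f ∘ suc)

sumℕ-mono-≤ : ∀ {k} {f g : Fin k → ℕ} → (∀ i → f i ℕ.≤ g i) → sumℕ f ℕ.≤ sumℕ g
sumℕ-mono-≤ {zero}  _   = ℕ.z≤n
sumℕ-mono-≤ {suc k} f≤g = ℕₚ.+-mono-≤ (f≤g zero) (sumℕ-mono-≤ (f≤g ∘ suc))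

sumℕ-mono-< : ∀ {k} {f g : Fin k → ℕ} → (∀ i → f i ℕ.≤ g i) → ∀ a → f a ℕ.< g a → sumℕ f ℕ.< sumℕ g
sumℕ-mono-< f≤g zero    fa<ga = ℕₚ.+-mono-<-≤ fa<ga (sumℕ-mono-≤ (f≤g ∘ suc))
sumℕ-mono-< f≤g (suc a) fa<ga = ℕₚ.+-mono-≤-< (f≤g zero) (sumℕ-mono-< (f≤g ∘ suc) a fa<ga)

nonBinaryCount : ∀ {k n} → (Fin k → Fin n → ℚ) → ℕ
nonBinaryCount Y = sumℕ λ i → sumℕ λ v → countNo (binary? (Y i v))

nonBinaryCount-< : ∀ {k n} {Y Z : Fin k → Fin n → ℚ} → (∀ i v → IsBinary (Y i v) → IsBinary (Z i v)) →
                   ∀ i v → ¬ IsBinary (Y i v) → IsBinary (Z i v) → nonBinaryCount Z ℕ.< nonBinaryCount Y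
nonBinaryCount-< {Y = Y} {Z} Y⇒Z i v ¬binaryY binaryZ =
  sumℕ-mono-< (λ i′ → sumℕ-mono-≤ (entry-≤ i′)) i
    (sumℕ-mono-< (entry-≤ i) v (countNo-< (binary? (Y i v)) (binary? (Z i v)) ¬binaryY binaryZ))
  where
  entry-≤ : ∀ i v → countNo (binary? (Z i v)) ℕ.≤ countNo (binary? (Y i v))
  entry-≤ i v = countNo-≤ (binary? (Y i v)) (binary? (Z i v)) (Y⇒Z i v)

reflect : Bool → ℚ → ℚ
reflect true  p = p
reflect false p = 1ℚ - p

reflect-involutive : ∀ s p → reflect s (reflect s p) ≡ p
reflect-involutive true  p = refl
reflect-involutive false p = solve 1 (λ p → con 1ℚ :- (con 1ℚ :- p) := p) refl p

reflect-convex : ∀ s t p q → reflect s (t * p + (1ℚ - t) * q) ≡ t * reflect s p + (1ℚ - t) * reflect s q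
reflect-convex true  t p q = refl
reflect-convex false t p q = solve 3 (λ t p q → con 1ℚ :- (t :* p :+ (con 1ℚ :- t) :* q)
                                                := t :* (con 1ℚ :- p) :+ (con 1ℚ :- t) :* (con 1ℚ :- q)) refl t p q

reflect-binary : ∀ s {p} → IsBinary p → IsBinary (reflect s p)
reflect-binary true  binary      = binary
reflect-binary false (inj₁ refl) = inj₂ refl
reflect-binary false (inj₂ refl) = inj₁ refl

reflect-open : ∀ s {p} → 0ℚ < p × p < 1ℚ → 0ℚ < reflect s p × reflect s p < 1ℚ
reflect-open true  0<p×p<1 = 0<p×p<1
reflect-open false {p} (0<p , p<1) =
  p<1⇒0<1-p p<1 , subst (1ℚ - p <_) (+-identityʳ 1ℚ) (+-monoʳ-< 1ℚ (neg-antimono-< 0<p))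

conj : Bool → (ℚ → ℚ) → ℚ → ℚ
conj s g p = reflect s (g (reflect s p))

record IsMonotone01 (g : ℚ → ℚ) : Set where
  field
    monotone : g Preserves _≤_ ⟶ _≤_
    fix-0    : g 0ℚ ≡ 0ℚ
    fix-1    : g 1ℚ ≡ 1ℚ

  nonNeg : ∀ {p} → 0ℚ ≤ p → 0ℚ ≤ g p
  nonNeg 0≤p = subst (_≤ g _) fix-0 (monotone 0≤p)

  binary : ∀ {p} → IsBinary p → IsBinary (g p)
  binary (inj₁ refl) = inj₁ fix-0
  binary (inj₂ refl) = inj₂ fix-1

conj-monotone01 : ∀ s {g} → IsMonotone01 g → IsMonotone01 (conj s g)
conj-monotone01 true  mono01 = mono01
conj-monotone01 false mono01 = record
  { monotone = λ p≤q → antitone (monotone (antitone p≤q))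
  ; fix-0    = cong (λ x → 1ℚ - x) fix-1
  ; fix-1    = cong (λ x → 1ℚ - x) fix-0
  }
  where
  open IsMonotone01 mono01
  antitone : ∀ {p q} → p ≤ q → 1ℚ - q ≤ 1ℚ - p
  antitone p≤q = +-monoʳ-≤ 1ℚ (neg-antimono-≤ p≤q)

-- Across the bipartition 1 ≤ p + q says 1 - q ≤ p, which the monotone g preserves.
conj-cover : ∀ {g} → IsMonotone01 g → ∀ {s s′ p q} → s ≢ s′ → 1ℚ ≤ p + q →
             1ℚ ≤ conj s g p + conj s′ g q
conj-cover mono01 {true}  {true}  s≢s′ = ⊥-elim (s≢s′ refl)
conj-cover mono01 {false} {false} s≢s′ = ⊥-elim (s≢s′ refl)
conj-cover {g} mono01 {true} {false} {p} {q} _ 1≤p+q = begin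
  1ℚ                          ≡⟨ sym (+-identityʳ 1ℚ) ⟩
  1ℚ + 0ℚ                     ≤⟨ +-monoʳ-≤ 1ℚ (p≤q⇒0≤q-p (monotone 1-q≤p)) ⟩
  1ℚ + (g p - g (1ℚ - q))     ≡⟨ solve 2 (λ x y → con 1ℚ :+ (x :- y) := x :+ (con 1ℚ :- y)) refl
                                          (g p) (g (1ℚ - q)) ⟩
  g p + (1ℚ - g (1ℚ - q))     ∎
  where
  open ≤-Reasoning
  open IsMonotone01 mono01
  1-q≤p : 1ℚ - q ≤ p
  1-q≤p = subst (1ℚ - q ≤_) (solve 2 (λ p q → p :+ q :- q := p) refl p q) (+-monoˡ-≤ (- q) 1≤p+q)
conj-cover {g} mono01 {false} {true} {p} {q} _ 1≤p+q =
  subst (1ℚ ≤_) (+-comm (g q) _) (conj-cover mono01 {true} {false} (λ ()) (subst (1ℚ ≤_) (+-comm p q) 1≤p+q))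

record IsSplit (t : ℚ) (g₀ g₁ : ℚ → ℚ) : Set where
  field
    0<t       : 0ℚ < t
    t<1       : t < 1ℚ
    monotone₀ : IsMonotone01 g₀
    monotone₁ : IsMonotone01 g₁
    decompose : ∀ p → p ≡ t * g₀ p + (1ℚ - t) * g₁ p

  difference-decompose : ∀ p q → p - q ≡ t * (g₀ p - g₀ q) + (1ℚ - t) * (g₁ p - g₁ q)
  difference-decompose p q = trans (cong₂ _-_ (decompose p) (decompose q))
    (solve 5 (λ t a b c e → (t :* a :+ (con 1ℚ :- t) :* b) :- (t :* c :+ (con 1ℚ :- t) :* e)
                            := t :* (a :- c) :+ (con 1ℚ :- t) :* (b :- e)) refl t (g₀ p) (g₁ p) (g₀ q) (g₁ q))

  -- Both parts are monotone, so g₀ p - g₀ q and g₁ p - g₁ q have the sign of p - q.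
  ⁺-decompose : ∀ p q → (p - q) ⁺ ≡ t * (g₀ p - g₀ q) ⁺ + (1ℚ - t) * (g₁ p - g₁ q) ⁺
  ⁺-decompose p q =
    trans (cong _⁺ (difference-decompose p q)) (⁺-linear (<⇒≤ 0<t) (<⇒≤ (p<1⇒0<1-p t<1)) sameSign)
    where
    open IsMonotone01 monotone₀ renaming (monotone to mono₀)
    open IsMonotone01 monotone₁ renaming (monotone to mono₁)
    sameSign : SameSign (g₀ p - g₀ q) (g₁ p - g₁ q)
    sameSign with ≤-total p q
    ... | inj₁ p≤q = inj₂ (p≤q⇒p-q≤0 (mono₀ p≤q) , p≤q⇒p-q≤0 (mono₁ p≤q))
    ... | inj₂ q≤p = inj₁ (p≤q⇒0≤q-p (mono₀ q≤p) , p≤q⇒0≤q-p (mono₁ q≤p))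

conj-split : ∀ s {t g₀ g₁} → IsSplit t g₀ g₁ → IsSplit t (conj s g₀) (conj s g₁)
conj-split s {t} {g₀} {g₁} split = record
  { 0<t       = 0<t
  ; t<1       = t<1
  ; monotone₀ = conj-monotone01 s monotone₀
  ; monotone₁ = conj-monotone01 s monotone₁
  ; decompose = λ p → begin
      p                                                               ≡⟨ sym (reflect-involutive s p) ⟩
      reflect s (reflect s p)                                         ≡⟨ cong (reflect s) (decompose (reflect s p)) ⟩
      reflect s (t * g₀ (reflect s p) + (1ℚ - t) * g₁ (reflect s p))  ≡⟨ reflect-convex s t _ _ ⟩
      t * conj s g₀ p + (1ℚ - t) * conj s g₁ p                        ∎
  }
  where
  open IsSplit split
  open ≡-Reasoning

module Threshold {t : ℚ} (0<t : 0ℚ < t) (t<1 : t < 1ℚ) where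

  private
    instance
      t≢0   = >-nonZero 0<t
      1-t≢0 = >-nonZero (p<1⇒0<1-p t<1)

    *1/-monotone : ∀ r .{{_ : NonZero r}} → 0ℚ < r → (_* 1/ r) Preserves _≤_ ⟶ _≤_
    *1/-monotone r 0<r = *-monoʳ-≤-nonNeg (1/ r) {{nonNegative 0≤1/r}}
      where
      0≤1/r : 0ℚ ≤ 1/ r
      0≤1/r = <⇒≤ (positive⁻¹ _ {{1/pos⇒pos r {{positive 0<r}}}})

    *-cancel-*1/ : ∀ r .{{_ : NonZero r}} p → r * (p * 1/ r) ≡ p
    *-cancel-*1/ r p = begin
      r * (p * 1/ r)  ≡⟨ solve 3 (λ r p s → r :* (p :* s) := p :* (r :* s)) refl r p (1/ r) ⟩
      p * (r * 1/ r)  ≡⟨ cong (p *_) (*-inverseʳ r) ⟩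
      p * 1ℚ          ≡⟨ *-identityʳ p ⟩
      p               ∎
      where open ≡-Reasoning

    min+excess : ∀ p → p ⊓ t + (p - t) ⁺ ≡ p
    min+excess p with ≤-total p t
    ... | inj₁ p≤t = trans (cong₂ _+_ (p≤q⇒p⊓q≡p p≤t) (p≤0⇒p⁺≡0 (p≤q⇒p-q≤0 p≤t))) (+-identityʳ p)
    ... | inj₂ t≤p = trans (cong₂ _+_ (p≥q⇒p⊓q≡q t≤p) (0≤p⇒p⁺≡p (p≤q⇒0≤q-p t≤p)))
                           (solve 2 (λ t p → t :+ (p :- t) := p) refl t p)

  low : ℚ → ℚ
  low p = (p ⊓ t) * 1/ t

  high : ℚ → ℚ
  high p = (p - t) ⁺ * 1/ (1ℚ - t)

  low-monotone01 : IsMonotone01 low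
  low-monotone01 = record
    { monotone = λ p≤q → *1/-monotone t 0<t (⊓-monoˡ-≤ t p≤q)
    ; fix-0    = trans (cong (_* 1/ t) (p≤q⇒p⊓q≡p (<⇒≤ 0<t))) (*-zeroˡ (1/ t))
    ; fix-1    = trans (cong (_* 1/ t) (p≥q⇒p⊓q≡q (<⇒≤ t<1))) (*-inverseʳ t)
    }

  high-monotone01 : IsMonotone01 high
  high-monotone01 = record
    { monotone = λ p≤q → *1/-monotone (1ℚ - t) (p<1⇒0<1-p t<1) (⊔-monoˡ-≤ 0ℚ (+-monoˡ-≤ (- t) p≤q))
    ; fix-0    = trans (cong (_* 1/ (1ℚ - t)) (p≤0⇒p⁺≡0 -t≤0)) (*-zeroˡ (1/ (1ℚ - t)))
    ; fix-1    = trans (cong (_* 1/ (1ℚ - t)) (0≤p⇒p⁺≡p (<⇒≤ (p<1⇒0<1-p t<1)))) (*-inverseʳ (1ℚ - t))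
    }
    where
    -t≤0 : 0ℚ - t ≤ 0ℚ
    -t≤0 = subst (_≤ 0ℚ) (sym (+-identityˡ (- t))) (neg-antimono-≤ (<⇒≤ 0<t))

  high-t≡0 : high t ≡ 0ℚ
  high-t≡0 = trans (cong (λ x → x ⁺ * 1/ (1ℚ - t)) (+-inverseʳ t)) (*-zeroˡ (1/ (1ℚ - t)))

  threshold-split : IsSplit t low high
  threshold-split = record
    { 0<t       = 0<t
    ; t<1       = t<1
    ; monotone₀ = low-monotone01
    ; monotone₁ = high-monotone01
    ; decompose = λ p → begin
        p                              ≡⟨ sym (min+excess p) ⟩
        p ⊓ t + (p - t) ⁺              ≡⟨ sym (cong₂ _+_ (*-cancel-*1/ t (p ⊓ t))
                                                         (*-cancel-*1/ (1ℚ - t) ((p - t) ⁺))) ⟩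
        t * low p + (1ℚ - t) * high p  ∎
    }
    where open ≡-Reasoning

sumFin-linear : ∀ {n} a b {f g h : Fin n → ℚ} → (∀ i → h i ≡ a * f i + b * g i) →
                sumFin h ≡ a * sumFin f + b * sumFin g
sumFin-linear {zero}  a b _ = solve 2 (λ a b → con 0ℚ := a :* con 0ℚ :+ b :* con 0ℚ) refl a b
sumFin-linear {suc n} a b {f} {g} h≡af+bg =
  trans (cong₂ _+_ (h≡af+bg zero) (sumFin-linear a b (h≡af+bg ∘ suc)))
        (solve 6 (λ a b x y X Y → (a :* x :+ b :* y) :+ (a :* X :+ b :* Y) := a :* (x :+ X) :+ b :* (y :+ Y)) refl
           a b (f zero) (g zero) (sumFin (f ∘ suc)) (sumFin (g ∘ suc)))

sumFin-nonNeg : ∀ {n} {f : Fin n → ℚ} → (∀ i → 0ℚ ≤ f i) → 0ℚ ≤ sumFin f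
sumFin-nonNeg {zero}  _   = ≤-refl
sumFin-nonNeg {suc n} 0≤f = +-mono-≤ (0≤f zero) (sumFin-nonNeg (0≤f ∘ suc))

updateAt-cases : ∀ {A : Set} {n} (f : Fin n → A) a {g : A → A} w →
                 updateAt f a g w ≡ g (f a) ⊎ updateAt f a g w ≡ f w
updateAt-cases f a w with w ≟ᶠ a
... | yes refl = inj₁ (updateAt-updates a f)
... | no  w≢a  = inj₂ (updateAt-minimal w a f w≢a)

sumFin-updateAt : ∀ {n} (f : Fin n → ℚ) a (g : ℚ → ℚ) → f a + sumFin (updateAt f a g) ≡ g (f a) + sumFin f
sumFin-updateAt f zero    g = x∙yz≈y∙xz (f zero) (g (f zero)) (sumFin (f ∘ suc))
sumFin-updateAt f (suc a) g = begin
  f (suc a) + (f zero + sumFin (updateAt (f ∘ suc) a g))  ≡⟨ x∙yz≈y∙xz (f (suc a)) (f zero) _ ⟩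
  f zero + (f (suc a) + sumFin (updateAt (f ∘ suc) a g))  ≡⟨ cong (f zero +_) (sumFin-updateAt (f ∘ suc) a g) ⟩
  f zero + (g (f (suc a)) + sumFin (f ∘ suc))             ≡⟨ x∙yz≈y∙xz (f zero) (g (f (suc a))) _ ⟩
  g (f (suc a)) + sumFin f                                ∎
  where open ≡-Reasoning

sumList : ∀ {n} → (Fin n → ℚ) → List (Fin n) → ℚ
sumList f []       = 0ℚ
sumList f (v ∷ vs) = f v + sumList f vs

sumList-updateAt-∉ : ∀ {n} (f : Fin n → ℚ) {a g} {vs : List (Fin n)} → All (a ≢_) vs →
                     sumList (updateAt f a g) vs ≡ sumList f vs
sumList-updateAt-∉ f []             = refl
sumList-updateAt-∉ f (a≢v ∷ a∉vs) = cong₂ _+_ (updateAt-minimal _ _ f (a≢v ∘ sym)) (sumList-updateAt-∉ f a∉vs)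

sumList≤sumFin : ∀ {n} {f : Fin n → ℚ} {vs} → Unique vs → (∀ v → 0ℚ ≤ f v) → sumList f vs ≤ sumFin f
sumList≤sumFin {f = f} {[]}     []              0≤f = sumFin-nonNeg 0≤f
sumList≤sumFin {f = f} {a ∷ vs} (a∉vs ∷ unique) 0≤f = begin
  f a + sumList f vs   ≡⟨ cong (f a +_) (sym (sumList-updateAt-∉ f a∉vs)) ⟩
  f a + sumList f₀ vs  ≤⟨ +-monoʳ-≤ (f a) (sumList≤sumFin unique 0≤f₀) ⟩
  f a + sumFin f₀      ≡⟨ trans (sumFin-updateAt f a (λ _ → 0ℚ)) (+-identityˡ (sumFin f)) ⟩
  sumFin f             ∎
  where
  open ≤-Reasoning
  f₀ : Fin _ → ℚ
  f₀ = updateAt f a (λ _ → 0ℚ)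
  0≤f₀ : ∀ v → 0ℚ ≤ f₀ v
  0≤f₀ v with updateAt-cases f a v
  ... | inj₁ f₀v≡0  = subst (0ℚ ≤_) (sym f₀v≡0) ≤-refl
  ... | inj₂ f₀v≡fv = subst (0ℚ ≤_) (sym f₀v≡fv) (0≤f v)

conjBy : ∀ {n} → (Fin n → Bool) → (ℚ → ℚ) → (Fin n → ℚ) → Fin n → ℚ
conjBy side g y v = conj (side v) g (y v)

module _ {n : ℕ} (E : Fin n → Fin n → Bool) where

  Covers : (Fin n → ℚ) → Set
  Covers y = ∀ u v → E u v ≡ true → 1ℚ ≤ y u + y v

  matchedVertices : List (Fin n × Fin n) → List (Fin n)
  matchedVertices = concatMap (λ e → proj₁ e ∷ proj₂ e ∷ [])

  size≤sumList-matched : ∀ {y} M → All (λ e → E (proj₁ e) (proj₂ e) ≡ true) M → Covers y →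
                         ℕtoℚ (length M) ≤ sumList y (matchedVertices M)
  size≤sumList-matched     []            []           covers = ≤-refl
  size≤sumList-matched {y} ((u , v) ∷ M) (uv∈E ∷ M⊆E) covers = begin
    ℕtoℚ (suc (length M))                        ≡⟨ ℕtoℚ-suc (length M) ⟩
    1ℚ + ℕtoℚ (length M)                         ≤⟨ +-mono-≤ (covers u v uv∈E) (size≤sumList-matched M M⊆E covers) ⟩
    (y u + y v) + sumList y (matchedVertices M)  ≡⟨ +-assoc (y u) (y v) _ ⟩
    sumList y (matchedVertices ((u , v) ∷ M))    ∎
    where open ≤-Reasoning

  matchingNumber≤cover : ∀ {k y} → IsMatchingNumber E k → (∀ v → 0ℚ ≤ y v) → Covers y → ℕtoℚ k ≤ sumFin y
  matchingNumber≤cover ((M , (M⊆E , unique) , refl) , _) 0≤y covers =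
    ≤-trans (size≤sumList-matched M M⊆E covers) (sumList≤sumFin unique 0≤y)

  record IsOptimalCover (V : Fin n → Bool) (k : ℕ) (y : Fin n → ℚ) : Set where
    field
      nonNeg  : ∀ v → 0ℚ ≤ y v
      covers  : Covers y
      size    : sumFin y ≡ ℕtoℚ k
      support : ∀ v → V v ≡ false → y v ≡ 0ℚ

  -- Resetting y v to 1 keeps a cover, so weak duality gives k ≤ k - y v + 1.
  optimalCover≤1 : ∀ {V k y} → IsMatchingNumber E k → IsOptimalCover V k y → ∀ v → y v ≤ 1ℚ
  optimalCover≤1 {V} {k} {y} ν≡k optimal v = +-cancelʳ-≤ (begin
    y v + ℕtoℚ k     ≤⟨ +-monoʳ-≤ (y v) (matchingNumber≤cover ν≡k 0≤y₁ covers₁) ⟩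
    y v + sumFin y₁  ≡⟨ sumFin-updateAt y v (λ _ → 1ℚ) ⟩
    1ℚ + sumFin y    ≡⟨ cong (1ℚ +_) size ⟩
    1ℚ + ℕtoℚ k      ∎)
    where
    open ≤-Reasoning
    open IsOptimalCover optimal
    y₁ : Fin n → ℚ
    y₁ = updateAt y v (λ _ → 1ℚ)
    0≤y₁ : ∀ w → 0ℚ ≤ y₁ w
    0≤y₁ w with updateAt-cases y v w
    ... | inj₁ y₁w≡1  = subst (0ℚ ≤_) (sym y₁w≡1) 0≤1
    ... | inj₂ y₁w≡yw = subst (0ℚ ≤_) (sym y₁w≡yw) (nonNeg w)
    covers₁ : Covers y₁
    covers₁ a b ab∈E with updateAt-cases y v a | updateAt-cases y v b
    ... | inj₁ y₁a≡1  | _           = subst (λ x → 1ℚ ≤ x + y₁ b) (sym y₁a≡1) (p≤p+q (0≤y₁ b))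
    ... | inj₂ _      | inj₁ y₁b≡1  = subst (λ x → 1ℚ ≤ y₁ a + x) (sym y₁b≡1) (p≤q+p (0≤y₁ a))
    ... | inj₂ y₁a≡ya | inj₂ y₁b≡yb = subst₂ (λ x z → 1ℚ ≤ x + z) (sym y₁a≡ya) (sym y₁b≡yb) (covers a b ab∈E)

  module _ {side : Fin n → Bool} (bipartite : ∀ u v → E u v ≡ true → side u ≢ side v)
           {V k y} (ν≡k : IsMatchingNumber E k) (optimal : IsOptimalCover V k y) where

    open IsOptimalCover optimal

    private
      conjBy-nonNeg : ∀ {g} → IsMonotone01 g → ∀ v → 0ℚ ≤ conjBy side g y v
      conjBy-nonNeg mono01 v = IsMonotone01.nonNeg (conj-monotone01 (side v) mono01) (nonNeg v)

      conjBy-covers : ∀ {g} → IsMonotone01 g → Covers (conjBy side g y)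
      conjBy-covers mono01 u v uv∈E = conj-cover mono01 (bipartite u v uv∈E) (covers u v uv∈E)

      conjBy-optimal : ∀ {g} → IsMonotone01 g → sumFin (conjBy side g y) ≡ ℕtoℚ k →
                       IsOptimalCover V k (conjBy side g y)
      conjBy-optimal {g} mono01 size′ = record
        { nonNeg  = conjBy-nonNeg mono01
        ; covers  = conjBy-covers mono01
        ; size    = size′
        ; support = λ v v∉V → trans (cong (conj (side v) g) (support v v∉V))
                                    (IsMonotone01.fix-0 (conj-monotone01 (side v) mono01))
        }

    -- Both parts are covers, so by weak duality each weighs at least k, and their convex combination weighs k.
    conjBy-optimalCover : ∀ {t g₀ g₁} → IsSplit t g₀ g₁ →
                          IsOptimalCover V k (conjBy side g₀ y) × IsOptimalCover V k (conjBy side g₁ y)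
    conjBy-optimalCover {t} {g₀} {g₁} split =
      conjBy-optimal monotone₀ (proj₁ sizes) , conjBy-optimal monotone₁ (proj₂ sizes)
      where
      open IsSplit split
      sizes : sumFin (conjBy side g₀ y) ≡ ℕtoℚ k × sumFin (conjBy side g₁ y) ≡ ℕtoℚ k
      sizes = convex-tight-≥ 0<t t<1
        (matchingNumber≤cover ν≡k (conjBy-nonNeg monotone₀) (conjBy-covers monotone₀))
        (matchingNumber≤cover ν≡k (conjBy-nonNeg monotone₁) (conjBy-covers monotone₁))
        (trans (sym (sumFin-linear t (1ℚ - t) (λ v → IsSplit.decompose (conj-split (side v) split) (y v)))) size)

mask : Bool → ℚ → ℚ
mask true  p = p
mask false p = 0ℚ

mask-nonNeg : ∀ b {p} → 0ℚ ≤ p → 0ℚ ≤ mask b p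
mask-nonNeg true  0≤p = 0≤p
mask-nonNeg false _   = ≤-refl

mask-false : ∀ {b} p → b ≡ false → mask b p ≡ 0ℚ
mask-false p refl = refl

≤-mask⁺ : ∀ {b} p → b ≡ true → p ≤ mask b (p ⁺)
≤-mask⁺ p refl = p≤p⁺ p

mask⁺-least : ∀ b {p q} → (b ≡ true → p ≤ q) → 0ℚ ≤ q → mask b (p ⁺) ≤ q
mask⁺-least true  p≤q 0≤q = ⊔-lub (p≤q refl) 0≤q
mask⁺-least false _   0≤q = 0≤q

mask-convex : ∀ b t p q → mask b (t * p + (1ℚ - t) * q) ≡ t * mask b p + (1ℚ - t) * mask b q
mask-convex true  t p q = refl
mask-convex false t p q = solve 1 (λ t → con 0ℚ := t :* con 0ℚ :+ (con 1ℚ :- t) :* con 0ℚ) refl t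

mask-binary : ∀ b {p} → IsBinary p → IsBinary (mask b p)
mask-binary true  binary = binary
mask-binary false _      = inj₁ refl

record IsConvexCombination {m n : ℕ} (t : ℚ) (x₀ x₁ x : Point m n) : Set where
  field
    y-convex : ∀ i v → y x i v ≡ t * y x₀ i v + (1ℚ - t) * y x₁ i v
    δ-convex : ∀ j v → δ x j v ≡ t * δ x₀ j v + (1ℚ - t) * δ x₁ j v
    d-convex : ∀ j v → d x j v ≡ t * d x₀ j v + (1ℚ - t) * d x₁ j v

dot-convex : ∀ {m n t} (c : Point m n) {x₀ x₁ x} → IsConvexCombination t x₀ x₁ x →
             dot c x ≡ t * dot c x₀ + (1ℚ - t) * dot c x₁
dot-convex {t = t} c {x₀} {x₁} {x} comb = begin
  dot c x
    ≡⟨ cong₂ _+_ (sumFin-linear t (1ℚ - t) (λ i → sumFin-linear t (1ℚ - t) (y-term i)))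
                 (sumFin-linear t (1ℚ - t) (λ j → sumFin-linear t (1ℚ - t) (δd-term j))) ⟩
  (t * Y₀ + (1ℚ - t) * Y₁) + (t * D₀ + (1ℚ - t) * D₁)
    ≡⟨ solve 5 (λ t a b c e → (t :* a :+ (con 1ℚ :- t) :* b) :+ (t :* c :+ (con 1ℚ :- t) :* e)
                              := t :* (a :+ c) :+ (con 1ℚ :- t) :* (b :+ e)) refl t Y₀ Y₁ D₀ D₁ ⟩
  t * dot c x₀ + (1ℚ - t) * dot c x₁
    ∎
  where
  open ≡-Reasoning
  open IsConvexCombination comb
  Y₀ Y₁ D₀ D₁ : ℚ
  Y₀ = sumFin (λ i → sumFin (λ v → y c i v * y x₀ i v))
  Y₁ = sumFin (λ i → sumFin (λ v → y c i v * y x₁ i v))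
  D₀ = sumFin (λ j → sumFin (λ v → δ c j v * δ x₀ j v + d c j v * d x₀ j v))
  D₁ = sumFin (λ j → sumFin (λ v → δ c j v * δ x₁ j v + d c j v * d x₁ j v))
  y-term : ∀ i v → y c i v * y x i v ≡ t * (y c i v * y x₀ i v) + (1ℚ - t) * (y c i v * y x₁ i v)
  y-term i v = trans (cong (y c i v *_) (y-convex i v))
    (solve 4 (λ t c a b → c :* (t :* a :+ (con 1ℚ :- t) :* b) := t :* (c :* a) :+ (con 1ℚ :- t) :* (c :* b)) refl
       t (y c i v) (y x₀ i v) (y x₁ i v))
  δd-term : ∀ j v → δ c j v * δ x j v + d c j v * d x j v ≡
                    t * (δ c j v * δ x₀ j v + d c j v * d x₀ j v) +
                    (1ℚ - t) * (δ c j v * δ x₁ j v + d c j v * d x₁ j v)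
  δd-term j v = trans (cong₂ (λ p q → δ c j v * p + d c j v * q) (δ-convex j v) (d-convex j v))
    (solve 7 (λ t c a b e f g → c :* (t :* a :+ (con 1ℚ :- t) :* b) :+ e :* (t :* f :+ (con 1ℚ :- t) :* g)
                                := t :* (c :* a :+ e :* f) :+ (con 1ℚ :- t) :* (c :* b :+ e :* g)) refl
       t (δ c j v) (δ x₀ j v) (δ x₁ j v) (d c j v) (d x₀ j v) (d x₁ j v))

IsValidInequality : ∀ {m n} → (Point m n → Set) → Point m n → ℚ → Set
IsValidInequality P c β = ∀ x → P x → dot c x ≤ β

face-convex : ∀ {m n} {P : Point m n → Set} c {β t x₀ x₁ x} → IsValidInequality P c β →
              0ℚ < t → t < 1ℚ → IsConvexCombination t x₀ x₁ x → P x₀ → P x₁ → dot c x ≡ β →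
              dot c x₀ ≡ β × dot c x₁ ≡ β
face-convex c valid 0<t t<1 comb P₀ P₁ cx≡β =
  convex-tight-≤ 0<t t<1 (valid _ P₀) (valid _ P₁) (trans (sym (dot-convex c comb)) cx≡β)

module LP {m n : ℕ} (V : Fin (suc m) → Fin n → Bool) (E : Fin (suc m) → Fin n → Fin n → Bool)
          (ν : Fin (suc m) → ℕ) where

  Shared : Fin m → Fin n → Bool
  Shared j v = V (inject₁ j) v ∧ V (suc j) v

  Weights : Set
  Weights = Fin (suc m) → Fin n → ℚ

  OptimalCovers : Weights → Set
  OptimalCovers Y = ∀ i → IsOptimalCover (E i) (V i) (ν i) (Y i)

  leastExtension : Weights → Point m n
  leastExtension Y = record
    { y = Y
    ; δ = λ j v → mask (Shared j v) ((Y (inject₁ j) v - Y (suc j) v) ⁺)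
    ; d = λ j v → mask (Shared j v) ((Y (suc j) v - Y (inject₁ j) v) ⁺)
    }

  leastExtension-feasible : ∀ {Y} → OptimalCovers Y → Feasible V E ν (leastExtension Y)
  leastExtension-feasible {Y} optimal =
    (λ i → covers (optimal i)) ,
    (λ i → size (optimal i)) ,
    (λ i → nonNeg (optimal i)) ,
    (λ i → support (optimal i)) ,
    (λ j v shared → ≤-mask⁺ _ shared , ≤-mask⁺ _ shared) ,
    (λ j v → mask-nonNeg (Shared j v) (0≤p⁺ (Y (inject₁ j) v - Y (suc j) v)) ,
             mask-nonNeg (Shared j v) (0≤p⁺ (Y (suc j) v - Y (inject₁ j) v))) ,
    (λ j v unshared → mask-false _ unshared , mask-false _ unshared)
    where open IsOptimalCover

  feasible⇒optimalCovers : ∀ {x} → Feasible V E ν x → OptimalCovers (y x)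
  feasible⇒optimalCovers (covers , size , nonNeg , support , _) i = record
    { nonNeg = nonNeg i ; covers = covers i ; size = size i ; support = support i }

  -- x is the midpoint of its least extension x̂ and of the feasible point 2x - x̂.
  leastExtension-on-face : ∀ c {β x} → IsValidInequality (Feasible V E ν) c β → Feasible V E ν x → dot c x ≡ β →
                           dot c (leastExtension (y x)) ≡ β
  leastExtension-on-face c {β} {x} valid feasible@(covers , size , nonNeg , support , gaps , 0≤δd , unshared⇒0) cx≡β =
    proj₂ (face-convex c valid 0<½ ½<1 midpoint feasible-far
                       (leastExtension-feasible (feasible⇒optimalCovers feasible)) cx≡β)
    where
    x̂ far : Point m n
    x̂ = leastExtension (y x)
    far = record
      { y = y x
      ; δ = λ j v → δ x j v + (δ x j v - δ x̂ j v)
      ; d = λ j v → d x j v + (d x j v - d x̂ j v)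
      }
    δ̂≤δ : ∀ j v → δ x̂ j v ≤ δ x j v
    δ̂≤δ j v = mask⁺-least (Shared j v) (λ shared → proj₁ (gaps j v shared)) (proj₁ (0≤δd j v))
    d̂≤d : ∀ j v → d x̂ j v ≤ d x j v
    d̂≤d j v = mask⁺-least (Shared j v) (λ shared → proj₂ (gaps j v shared)) (proj₂ (0≤δd j v))
    feasible-far : Feasible V E ν far
    feasible-far = covers , size , nonNeg , support ,
      (λ j v shared → ≤-trans (proj₁ (gaps j v shared)) (p≤p+q (p≤q⇒0≤q-p (δ̂≤δ j v))) ,
                      ≤-trans (proj₂ (gaps j v shared)) (p≤p+q (p≤q⇒0≤q-p (d̂≤d j v)))) ,
      (λ j v → ≤-trans (proj₁ (0≤δd j v)) (p≤p+q (p≤q⇒0≤q-p (δ̂≤δ j v))) ,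
               ≤-trans (proj₂ (0≤δd j v)) (p≤p+q (p≤q⇒0≤q-p (d̂≤d j v)))) ,
      (λ j v unshared → cong₂ (λ p q → p + (p - q)) (proj₁ (unshared⇒0 j v unshared)) (mask-false _ unshared) ,
                        cong₂ (λ p q → p + (p - q)) (proj₂ (unshared⇒0 j v unshared)) (mask-false _ unshared))
    midpoint-identity : ∀ p q → p ≡ ½ * (p + (p - q)) + (1ℚ - ½) * q
    midpoint-identity = solve 2 (λ p q → p := con ½ :* (p :+ (p :- q)) :+ (con 1ℚ :- con ½) :* q) refl
    midpoint : IsConvexCombination ½ far x̂ x
    midpoint = record
      { y-convex = λ i v → solve 1 (λ p → p := con ½ :* p :+ (con 1ℚ :- con ½) :* p) refl (y x i v)
      ; δ-convex = λ j v → midpoint-identity (δ x j v) (δ x̂ j v)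
      ; d-convex = λ j v → midpoint-identity (d x j v) (d x̂ j v)
      }

  conjAll : (Fin n → Bool) → (ℚ → ℚ) → Weights → Weights
  conjAll side g Y i = conjBy side g (Y i)

  leastExtension-split : ∀ side {t g₀ g₁ Y} → IsSplit t g₀ g₁ →
    IsConvexCombination t (leastExtension (conjAll side g₀ Y)) (leastExtension (conjAll side g₁ Y)) (leastExtension Y)
  leastExtension-split side {t} {g₀} {g₁} {Y} split = record
    { y-convex = λ i v → IsSplit.decompose (split-at v) (Y i v)
    ; δ-convex = λ j v → gap-convex j v (Y (inject₁ j) v) (Y (suc j) v)
    ; d-convex = λ j v → gap-convex j v (Y (suc j) v) (Y (inject₁ j) v)
    }
    where
    split-at : ∀ v → IsSplit t (conj (side v) g₀) (conj (side v) g₁)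
    split-at v = conj-split (side v) split
    gap-convex : ∀ j v p q → mask (Shared j v) ((p - q) ⁺) ≡
      t * mask (Shared j v) ((conj (side v) g₀ p - conj (side v) g₀ q) ⁺) +
      (1ℚ - t) * mask (Shared j v) ((conj (side v) g₁ p - conj (side v) g₁ q) ⁺)
    gap-convex j v p q =
      trans (cong (mask (Shared j v)) (IsSplit.⁺-decompose (split-at v) p q)) (mask-convex (Shared j v) t _ _)

  leastExtension-integral : ∀ {Y} → (∀ i v → IsBinary (Y i v)) → IntPoint (leastExtension Y)
  leastExtension-integral {Y} binary =
    (λ i v → binary⇒int (binary i v)) ,
    (λ j v → binary⇒int (mask-binary (Shared j v) (difference⁺-binary (binary (inject₁ j) v) (binary (suc j) v)))) ,
    (λ j v → binary⇒int (mask-binary (Shared j v) (difference⁺-binary (binary (suc j) v) (binary (inject₁ j) v))))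

module Rounding {m n : ℕ} {side : Fin n → Bool} {V : Fin (suc m) → Fin n → Bool}
                {E : Fin (suc m) → Fin n → Fin n → Bool} {ν : Fin (suc m) → ℕ}
                (bipartite : ∀ i u v → E i u v ≡ true → side u ≢ side v)
                (matchingNumber : ∀ i → IsMatchingNumber (E i) (ν i))
                (c : Point m n) {β : ℚ} (valid : IsValidInequality (Feasible V E ν) c β) where

  open LP V E ν

  OnFace : Weights → Set
  OnFace Y = dot c (leastExtension Y) ≡ β

  -- t is the fractional entry Y i v read from its side, so the high part of that entry is integral.
  round-step : ∀ {Y} → OptimalCovers Y → OnFace Y → ∀ i v → ¬ IsBinary (Y i v) →
               ∃ λ Y′ → OptimalCovers Y′ × OnFace Y′ × nonBinaryCount Y′ ℕ.< nonBinaryCount Y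
  round-step {Y} optimal onFace i v ¬binary = conjAll side high Y , optimal-high , onFace-high , fewer
    where
    0<t×t<1 : 0ℚ < reflect (side v) (Y i v) × reflect (side v) (Y i v) < 1ℚ
    0<t×t<1 = reflect-open (side v) (unit-nonBinary⇒open (IsOptimalCover.nonNeg (optimal i) v)
                                       (optimalCover≤1 (E i) (matchingNumber i) (optimal i) v) ¬binary)
    open Threshold (proj₁ 0<t×t<1) (proj₂ 0<t×t<1)
    optimal-parts : ∀ i → IsOptimalCover (E i) (V i) (ν i) (conjBy side low (Y i)) ×
                          IsOptimalCover (E i) (V i) (ν i) (conjBy side high (Y i))
    optimal-parts i = conjBy-optimalCover (E i) (bipartite i) (matchingNumber i) (optimal i) threshold-split
    optimal-high : OptimalCovers (conjAll side high Y)
    optimal-high = proj₂ ∘ optimal-parts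
    onFace-high : OnFace (conjAll side high Y)
    onFace-high = proj₂ (face-convex c valid (proj₁ 0<t×t<1) (proj₂ 0<t×t<1) (leastExtension-split side threshold-split)
                          (leastExtension-feasible (proj₁ ∘ optimal-parts)) (leastExtension-feasible optimal-high) onFace)
    fewer : nonBinaryCount (conjAll side high Y) ℕ.< nonBinaryCount Y
    fewer = nonBinaryCount-< {Y = Y} (λ i′ v′ → IsMonotone01.binary (conj-monotone01 (side v′) high-monotone01))
              i v ¬binary
              (subst IsBinary (sym (cong (reflect (side v)) high-t≡0)) (reflect-binary (side v) (inj₁ refl)))

  round : ∀ Y → Acc ℕ._<_ (nonBinaryCount Y) → OptimalCovers Y → OnFace Y →
          ∃ λ x → Feasible V E ν x × IntPoint x × dot c x ≡ β
  round Y (acc smaller) optimal onFace with any? (λ i → any? (λ v → ¬? (binary? (Y i v))))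
  ... | no noFractional = leastExtension Y , leastExtension-feasible optimal , leastExtension-integral allBinary , onFace
    where
    allBinary : ∀ i v → IsBinary (Y i v)
    allBinary i v = decidable-stable (binary? (Y i v)) (λ ¬binary → noFractional (i , v , ¬binary))
  ... | yes (i , v , ¬binary) =
    let Y′ , optimal′ , onFace′ , fewer = round-step optimal onFace i v ¬binary
    in round Y′ (smaller fewer) optimal′ onFace′

theorem4 : (m n : ℕ) (side : Fin n → Bool)
    (V : Fin (suc m) → Fin n → Bool)
    (E : Fin (suc m) → Fin n → Fin n → Bool)
    (ν : Fin (suc m) → ℕ)
    (λ' : Fin m → Fin n → ℚ) →
    (∀ i u v → E i u v ≡ true → (V i u ≡ true) × (V i v ≡ true) × (side u ≢ side v)) →
    (∀ i → IsMatchingNumber (E i) (ν i)) →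
    (∀ j v → (V (inject₁ j) v ∧ V (suc j) v) ≡ true → 0ℚ ≤ λ' j v) →
    IsIntegral (Feasible V E ν)
theorem4 m n side V E ν _ edges matchingNumber _ c β valid (x , feasible , cx≡β) =
  round (y x) (<-wellFounded _) (feasible⇒optimalCovers feasible) (leastExtension-on-face c valid feasible cx≡β)
  where
  open LP V E ν
  open Rounding (λ i u v uv∈E → proj₂ (proj₂ (edges i u v uv∈E))) matchingNumber c valid
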